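{- Let $\rho$ be an $n$-metric and consider the regular subdivision $\mathcal{R}_n^0(\rho)$ of the point set $\mathcal{R}_n^0=\{e_i-e_j: i,j\in[n]\}\subset\mathbb{R}^n$ obtained by giving the point $e_i-e_j$ ($i\neq j$) the height $\rho_{ij}$ and the origin the height $0$. Then: (a) $\mathcal{R}_n^0(\rho)$ is point-symmetric with respect to the origin (the map $v\mapsto -v$ sends cells to cells), and every maximal cell contains the origin; (b) for every index set $I$ of ordered pairs $(i,j)$ with $i\ne j$, the following are equivalent: (i) $\{p_{ij}:(i,j)\in I\}$ is the set of all points $p_{ij}$ contained in a facet of $\mathrm{KRW}(\rho)$; (ii) $\{e_i-e_j:(i,j)\in I\}\cup\{0\}$ is a maximal cell of $\mathcal{R}_n^0(\rho)$.
   Context: An $n$-metric is a real symmetric $n\times n$ matrix $\rho$ with zero diagonal, positive off-diagonal entries and satisfying the triangle inequality. For $i\neq j$ let $p_{ij}=(e_i-e_j)/\rho_{ij}\in\mathbb{R}^n$, and let $\mathrm{KRW}(\rho)=\mathrm{conv}\{p_{ij}:i\neq j\}$. For a finite point set $\mathcal{P}=\{a_1,\dots,a_k\}\subset\mathbb{R}^n$ and heights $\omega\in\mathbb{R}^k$, a subset $S\subseteq\mathcal P$ is a maximal cell (facet) of the regular subdivision $\mathcal P(\omega)$ if there is $c\in\mathbb{R}^n$ with $c\cdot a_j=\omega_j$ for $a_j\in S$ and $c\cdot a_j<\omega_j$ for $a_j\notin S$. -}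

module Defs where

open import Level using (Level; _⊔_) renaming (suc to lsuc)
open import Data.Nat using (ℕ; zero; suc)
open import Data.Fin using (Fin; zero; suc; _≟_)
open import Data.Bool using (Bool; true; false; if_then_else_)
open import Data.Maybe using (Maybe; just; nothing)
open import Data.Product using (Σ; Σ-syntax; _×_; _,_; proj₁; proj₂)
open import Data.Sum using (_⊎_)
open import Function using (_∘_)
open import Function.Bundles using (_⇔_)
open import Relation.Nullary using (¬_; does)
open import Relation.Binary.Core using (Rel)
open import Relation.Binary.Structures using (IsStrictTotalOrder)
open import Relation.Binary.PropositionalEquality using (_≡_; _≢_; ≢-sym)
open import Algebra.Bundles using (CommutativeRing)

-- Ordered fields (the paper works over ℝ; the standard library has no
-- reals, so we work over an arbitrary ordered field, which includes ℝ).

record OrderedField (c ℓ₁ ℓ₂ : Level) : Set (lsuc (c ⊔ ℓ₁ ⊔ ℓ₂)) where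
  field
    commutativeRing : CommutativeRing c ℓ₁
  open CommutativeRing commutativeRing public
  infix 4 _<_
  field
    _<_                : Rel Carrier ℓ₂
    isStrictTotalOrder : IsStrictTotalOrder _≈_ _<_
    +-monoˡ-<          : ∀ {x y} z → x < y → x + z < y + z
    *-pos              : ∀ {x y} → 0# < x → 0# < y → 0# < x * y
    0<1                : 0# < 1#
    _⁻¹                : Carrier → Carrier
    ⁻¹-inverse         : ∀ x → ¬ (x ≈ 0#) → x * (x ⁻¹) ≈ 1#

  infix 4 _≤_
  _≤_ : Rel Carrier (ℓ₁ ⊔ ℓ₂)
  x ≤ y = (x < y) ⊎ (x ≈ y)

OffDiag : ℕ → Set
OffDiag n = Σ (Fin n × Fin n) (λ p → proj₁ p ≢ proj₂ p)

-- the point set R_n^0 = {e_i - e_j}: 'nothing' is the origin,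
-- 'just (i , j)' (with i ≠ j) is the point e_i - e_j
Pt : ℕ → Set
Pt n = Maybe (OffDiag n)

negPt : ∀ {n} → Pt n → Pt n
negPt nothing = nothing
negPt (just ((i , j) , i≢j)) = just ((j , i) , ≢-sym i≢j)

module Geometry {c ℓ₁ ℓ₂} (𝔽 : OrderedField c ℓ₁ ℓ₂) where
  open OrderedField 𝔽 hiding (zero)

  sumF : ∀ {n} → (Fin n → Carrier) → Carrier
  sumF {zero}  f = 0#
  sumF {suc n} f = f zero + sumF (f ∘ suc)

  Vect : ℕ → Set c
  Vect n = Fin n → Carrier

  infix 7 _·_
  _·_ : ∀ {n} → Vect n → Vect n → Carrier
  u · v = sumF (λ k → u k * v k)

  e : ∀ {n} → Fin n → Vect n
  e i k = if does (i ≟ k) then 1# else 0#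

  record IsMetric (n : ℕ) (ρ : Fin n → Fin n → Carrier) : Set (c ⊔ ℓ₁ ⊔ ℓ₂) where
    field
      symm     : ∀ i j → ρ i j ≈ ρ j i
      diag     : ∀ i → ρ i i ≈ 0#
      pos      : ∀ i j → i ≢ j → 0# < ρ i j
      triangle : ∀ i j k → ρ i k ≤ ρ i j + ρ j k

  module _ {n : ℕ} (ρ : Fin n → Fin n → Carrier) where

    p : Fin n → Fin n → Vect n
    p i j k = (e i k - e j k) * (ρ i j ⁻¹)

    InKRW : Vect n → Set (c ⊔ ℓ₁ ⊔ ℓ₂)
    InKRW x = Σ[ t ∈ (Fin n → Fin n → Carrier) ]
                ((∀ i j → 0# ≤ t i j)
               × (∀ i → t i i ≈ 0#)
               × (sumF (λ i → sumF (λ j → t i j)) ≈ 1#)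
               × (∀ k → x k ≈ sumF (λ i → sumF (λ j → t i j * p i j k))))

    Face : Vect n → Vect n → Set (c ⊔ ℓ₁ ⊔ ℓ₂)
    Face w x = InKRW x × (∀ y → InKRW y → w · y ≤ w · x)

    ProperFace : Vect n → Set (c ⊔ ℓ₁ ⊔ ℓ₂)
    ProperFace w = Σ[ x ∈ Vect n ] (InKRW x × ¬ Face w x)

    IsFacet : Vect n → Set (c ⊔ ℓ₁ ⊔ ℓ₂)
    IsFacet w = ProperFace w
              × (∀ w' → (∀ x → Face w x → Face w' x) → ProperFace w'
                      → ∀ x → Face w' x → Face w x)

    FacetPointSet : (Fin n → Fin n → Bool) → Set (c ⊔ ℓ₁ ⊔ ℓ₂)
    FacetPointSet I = Σ[ w ∈ Vect n ]
                        (IsFacet w × (∀ i j → i ≢ j → (I i j ≡ true ⇔ Face w (p i j))))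

    pt : Pt n → Vect n
    pt nothing                = λ _ → 0#
    pt (just ((i , j) , _)) = λ k → e i k - e j k

    ht : Pt n → Carrier
    ht nothing                = 0#
    ht (just ((i , j) , _)) = ρ i j

    IsCell : (Pt n → Bool) → Set (c ⊔ ℓ₁ ⊔ ℓ₂)
    IsCell S = Σ[ w ∈ Vect n ] (∀ a → (S a ≡ true → w · pt a ≈ ht a)
                                     × (S a ≡ false → w · pt a < ht a))

    IsMaximalCell : (Pt n → Bool) → Set (c ⊔ ℓ₁ ⊔ ℓ₂)
    IsMaximalCell S = IsCell S
                    × (∀ S' → IsCell S' → (∀ a → S a ≡ true → S' a ≡ true)
                            → ∀ a → S' a ≡ true → S a ≡ true)

    cellOf : (Fin n → Fin n → Bool) → Pt n → Bool
    cellOf I nothing                = true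
    cellOf I (just ((i , j) , _)) = I i j

{-# OPTIONS --safe #-}
module Submission where

-- Faces of KRW(ρ) and cells of R_n^0(ρ) are both cut out by linear functionals, and both are
-- governed by the slopes w · p_ij = (w_i − w_j) / ρ_ij. If M > 0 is the largest slope of w, the
-- face of w consists of the convex combinations of the p_ij of slope M. A cell is cut out by some
-- u all of whose slopes are ≤ 1 (the origin is always tight) and consists of 0 and the e_i − e_j
-- of slope 1. Dividing w by M passes from the first situation to the second without changing the
-- tight pairs, and more tight pairs give a larger face, so maximal cells correspond to maximal
-- proper faces, i.e. facets. Two distinct indices provide a pair of nonpositive slope, which makes
-- these faces proper; by the triangle inequality the distance function ρ(·, o) cuts out a cell,
-- so no maximal cell is {0}. Point symmetry comes from u ↦ −u and ρ_ij = ρ_ji.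

open import Level using (_⊔_)
open import Data.Nat using (ℕ; zero; suc)
open import Data.Fin using (Fin; zero; suc; _≟_)
open import Data.Fin.Properties using (any?)
open import Data.Bool using (Bool; true; false)
open import Data.Bool.Properties using (not-¬) renaming (_≟_ to _≟ᵇ_)
open import Data.Maybe using (just; nothing)
open import Data.Product using (Σ; ∃₂; _×_; _,_; proj₁; proj₂)
open import Data.Sum as Sum using (_⊎_; inj₁; inj₂)
open import Data.Empty using (⊥-elim)
open import Data.List using (List; allFin; cartesianProduct)
open import Data.List.Membership.Propositional.Properties using (∈-allFin; ∈-cartesianProduct⁺)
import Data.List.Relation.Unary.All as All
import Data.List.Extrema as Extrema
open import Function using (id; _∘_; _$_)
open import Function.Bundles using (_⇔_; mk⇔; module Equivalence)
open Equivalence using (to; from)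
open import Function.Construct.Composition using (_⇔-∘_)
open import Function.Construct.Symmetry using (⇔-sym)
open import Relation.Nullary using (¬_; yes; no; does)
open import Relation.Binary.Bundles using (StrictTotalOrder)
import Relation.Binary.Properties.StrictTotalOrder as StrictTotalOrderProperties
open import Relation.Binary.Definitions using (tri<; tri≈; tri>)
open import Relation.Binary.PropositionalEquality as ≡ using (_≡_; _≢_; ≢-sym)
import Algebra.Properties.Ring as RingProperties
import Algebra.Properties.AbelianGroup as AbelianGroupProperties
import Algebra.Properties.Group as GroupProperties
open import Algebra.Properties.CommutativeSemigroup using (interchange; x∙yz≈y∙xz; xy∙z≈xz∙y)

open import Defs

module OrderedFieldProperties {c ℓ₁ ℓ₂} (𝔽 : OrderedField c ℓ₁ ℓ₂) where
  open OrderedField 𝔽 hiding (zero)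

  strictTotalOrder : StrictTotalOrder c ℓ₁ ℓ₂
  strictTotalOrder = record { isStrictTotalOrder = isStrictTotalOrder }

  open StrictTotalOrder strictTotalOrder public
    using (compare; irrefl; strictPartialOrder) renaming (_≟_ to _≈?_)
  open StrictTotalOrderProperties strictTotalOrder public
    using (≤-respˡ-≈; ≤-respʳ-≈)
    renaming (reflexive to ≤-reflexive; trans to ≤-trans; antisym to ≤-antisym; total to ≤-total)
  open RingProperties ring public using ([y-z]x≈yx-zx; x[y-z]≈xy-xz)
  open AbelianGroupProperties +-abelianGroup public using (⁻¹-∙-comm)
  open GroupProperties +-group public using (⁻¹-involutive) renaming (ε⁻¹≈ε to -0#≈0#)
  open import Relation.Binary.Reasoning.StrictPartialOrder strictPartialOrder

  +-monoʳ-< : ∀ {x y} z → x < y → z + x < z + y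
  +-monoʳ-< {x} {y} z x<y = begin-strict
    z + x  ≈⟨ +-comm z x ⟩
    x + z  <⟨ +-monoˡ-< z x<y ⟩
    y + z  ≈⟨ +-comm y z ⟩
    z + y  ∎

  +-monoˡ-≤ : ∀ {x y} z → x ≤ y → x + z ≤ y + z
  +-monoˡ-≤ z (inj₁ x<y) = inj₁ (+-monoˡ-< z x<y)
  +-monoˡ-≤ z (inj₂ x≈y) = inj₂ (+-congʳ x≈y)

  +-monoʳ-≤ : ∀ {x y} z → x ≤ y → z + x ≤ z + y
  +-monoʳ-≤ z (inj₁ x<y) = inj₁ (+-monoʳ-< z x<y)
  +-monoʳ-≤ z (inj₂ x≈y) = inj₂ (+-congˡ x≈y)

  +-mono-≤ : ∀ {x y u v} → x ≤ y → u ≤ v → x + u ≤ y + v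
  +-mono-≤ {y = y} {u} x≤y u≤v = ≤-trans (+-monoˡ-≤ u x≤y) (+-monoʳ-≤ y u≤v)

  +-mono-<-≤ : ∀ {x y u v} → x < y → u ≤ v → x + u < y + v
  +-mono-<-≤ {x} {y} {u} {v} x<y u≤v = begin-strict
    x + u  <⟨ +-monoˡ-< u x<y ⟩
    y + u  ≤⟨ +-monoʳ-≤ y u≤v ⟩
    y + v  ∎

  +-mono-≤-< : ∀ {x y u v} → x ≤ y → u < v → x + u < y + v
  +-mono-≤-< {x} {y} {u} {v} x≤y u<v = begin-strict
    x + u  ≤⟨ +-monoˡ-≤ u x≤y ⟩
    y + u  <⟨ +-monoʳ-< y u<v ⟩
    y + v  ∎

  +-≤-equality : ∀ {x y u v} → x ≤ y → u ≤ v → x + u ≈ y + v → x ≈ y × u ≈ v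
  +-≤-equality (inj₂ x≈y) (inj₂ u≈v) _   = x≈y , u≈v
  +-≤-equality (inj₁ x<y) u≤v        eq  = ⊥-elim (irrefl eq (+-mono-<-≤ x<y u≤v))
  +-≤-equality (inj₂ x≈y) (inj₁ u<v) eq  = ⊥-elim (irrefl eq (+-mono-≤-< (inj₂ x≈y) u<v))

  x-y≤0⇔x≤y : ∀ {x y} → x - y ≤ 0# ⇔ x ≤ y
  x-y≤0⇔x≤y {x} {y} = mk⇔ x-y≤0⇒x≤y x≤y⇒x-y≤0
    where
    x-y≤0⇒x≤y : x - y ≤ 0# → x ≤ y
    x-y≤0⇒x≤y x-y≤0 = begin
      x             ≈⟨ +-identityʳ x ⟨
      x + 0#        ≈⟨ +-congˡ (-‿inverseˡ y) ⟨
      x + (- y + y) ≈⟨ +-assoc x (- y) y ⟨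
      x - y + y     ≤⟨ +-monoˡ-≤ y x-y≤0 ⟩
      0# + y        ≈⟨ +-identityˡ y ⟩
      y             ∎
    x≤y⇒x-y≤0 : x ≤ y → x - y ≤ 0#
    x≤y⇒x-y≤0 x≤y = begin
      x - y  ≤⟨ +-monoˡ-≤ (- y) x≤y ⟩
      y - y  ≈⟨ -‿inverseʳ y ⟩
      0#     ∎

  ≤∧≉⇒< : ∀ {x y} → x ≤ y → ¬ x ≈ y → x < y
  ≤∧≉⇒< (inj₁ x<y) _   = x<y
  ≤∧≉⇒< (inj₂ x≈y) x≉y = ⊥-elim (x≉y x≈y)

  ≤-congˡ-⇔ : ∀ {x y z} → x ≈ y → x ≤ z ⇔ y ≤ z
  ≤-congˡ-⇔ x≈y = mk⇔ (≤-respˡ-≈ x≈y) (≤-respˡ-≈ (sym x≈y))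

  ≈-congˡ-⇔ : ∀ {x y z} → x ≈ y → x ≈ z ⇔ y ≈ z
  ≈-congˡ-⇔ x≈y = mk⇔ (trans (sym x≈y)) (trans x≈y)

  -x--y≈y-x : ∀ x y → - x - - y ≈ y - x
  -x--y≈y-x x y = trans (+-congˡ (⁻¹-involutive y)) (+-comm (- x) y)

  x≤y+z⇒x-z≤y : ∀ {x y z} → x ≤ y + z → x - z ≤ y
  x≤y+z⇒x-z≤y {x} {y} {z} x≤y+z = begin
    x - z          ≤⟨ +-monoˡ-≤ (- z) x≤y+z ⟩
    y + z - z      ≈⟨ +-assoc y z (- z) ⟩
    y + (z - z)    ≈⟨ +-congˡ (-‿inverseʳ z) ⟩
    y + 0#         ≈⟨ +-identityʳ y ⟩
    y              ∎

  x<y⇒0<y-x : ∀ {x y} → x < y → 0# < y - x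
  x<y⇒0<y-x {x} {y} x<y = begin-strict
    0#     ≈⟨ -‿inverseʳ x ⟨
    x - x  <⟨ +-monoˡ-< (- x) x<y ⟩
    y - x  ∎

  0<y-x⇒x<y : ∀ {x y} → 0# < y - x → x < y
  0<y-x⇒x<y {x} {y} 0<y-x = begin-strict
    x             ≈⟨ +-identityʳ x ⟨
    x + 0#        <⟨ +-monoʳ-< x 0<y-x ⟩
    x + (y - x)   ≈⟨ +-congˡ (+-comm y (- x)) ⟩
    x + (- x + y) ≈⟨ +-assoc x (- x) y ⟨
    x - x + y     ≈⟨ +-congʳ (-‿inverseʳ x) ⟩
    0# + y        ≈⟨ +-identityˡ y ⟩
    y             ∎

  *-monoʳ-<-pos : ∀ {x y z} → 0# < z → x < y → x * z < y * z
  *-monoʳ-<-pos {x} {y} {z} 0<z x<y = 0<y-x⇒x<y $ begin-strict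
    0#             <⟨ *-pos (x<y⇒0<y-x x<y) 0<z ⟩
    (y - x) * z    ≈⟨ [y-z]x≈yx-zx z y x ⟩
    y * z - x * z  ∎

  *-monoʳ-≤-pos : ∀ {x y z} → 0# < z → x ≤ y → x * z ≤ y * z
  *-monoʳ-≤-pos 0<z (inj₁ x<y) = inj₁ (*-monoʳ-<-pos 0<z x<y)
  *-monoʳ-≤-pos 0<z (inj₂ x≈y) = inj₂ (*-congʳ x≈y)

  *-cancelʳ-≤-pos : ∀ {x y z} → 0# < z → x * z ≤ y * z → x ≤ y
  *-cancelʳ-≤-pos {x} {y} {z} 0<z xz≤yz with compare x y
  ... | tri< x<y _ _ = inj₁ x<y
  ... | tri≈ _ x≈y _ = inj₂ x≈y
  ... | tri> _ _ y<x = ⊥-elim $ irrefl refl $ begin-strict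
    x * z  ≤⟨ xz≤yz ⟩
    y * z  <⟨ *-monoʳ-<-pos 0<z y<x ⟩
    x * z  ∎

  *-cancelʳ-≈-pos : ∀ {x y z} → 0# < z → x * z ≈ y * z → x ≈ y
  *-cancelʳ-≈-pos 0<z xz≈yz =
    ≤-antisym (*-cancelʳ-≤-pos 0<z (inj₂ xz≈yz)) (*-cancelʳ-≤-pos 0<z (inj₂ (sym xz≈yz)))

  *-cancelˡ-≈-pos : ∀ {x y z} → 0# < z → z * x ≈ z * y → x ≈ y
  *-cancelˡ-≈-pos {x} {y} {z} 0<z zx≈zy =
    *-cancelʳ-≈-pos 0<z (trans (*-comm x z) (trans zx≈zy (*-comm z y)))

  x≈0⇒x*y≈x*z : ∀ {x y z} → x ≈ 0# → x * y ≈ x * z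
  x≈0⇒x*y≈x*z {x} {y} {z} x≈0 = begin-equality
    x * y   ≈⟨ *-congʳ x≈0 ⟩
    0# * y  ≈⟨ zeroˡ y ⟩
    0#      ≈⟨ zeroˡ z ⟨
    0# * z  ≈⟨ *-congʳ x≈0 ⟨
    x * z   ∎

  *-monoˡ-≤-nonNeg : ∀ {x y z} → 0# ≤ z → x ≤ y → z * x ≤ z * y
  *-monoˡ-≤-nonNeg {x} {y} {z} (inj₁ 0<z) x≤y = begin
    z * x  ≈⟨ *-comm z x ⟩
    x * z  ≤⟨ *-monoʳ-≤-pos 0<z x≤y ⟩
    y * z  ≈⟨ *-comm y z ⟩
    z * y  ∎
  *-monoˡ-≤-nonNeg (inj₂ 0≈z) _ = ≤-reflexive (x≈0⇒x*y≈x*z (sym 0≈z))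

  x*z≤0⇔x≤0 : ∀ {x z} → 0# < z → x * z ≤ 0# ⇔ x ≤ 0#
  x*z≤0⇔x≤0 {x} {z} 0<z = mk⇔
    (λ xz≤0 → *-cancelʳ-≤-pos 0<z (≤-respʳ-≈ (sym (zeroˡ z)) xz≤0))
    (λ x≤0 → ≤-respʳ-≈ (zeroˡ z) (*-monoʳ-≤-pos 0<z x≤0))

  x*x⁻¹≈1 : ∀ {x} → 0# < x → x * x ⁻¹ ≈ 1#
  x*x⁻¹≈1 {x} 0<x = ⁻¹-inverse x (λ x≈0 → irrefl (sym x≈0) 0<x)

  ⁻¹-pos : ∀ {x} → 0# < x → 0# < x ⁻¹
  ⁻¹-pos {x} 0<x with compare 0# (x ⁻¹)
  ... | tri< 0<x⁻¹ _ _ = 0<x⁻¹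
  ... | tri≈ _ 0≈x⁻¹ _ = ⊥-elim $ irrefl (sym 1≈0) 0<1
    where
    1≈0 : 1# ≈ 0#
    1≈0 = begin-equality
      1#         ≈⟨ x*x⁻¹≈1 0<x ⟨
      x * x ⁻¹   ≈⟨ *-congˡ 0≈x⁻¹ ⟨
      x * 0#     ≈⟨ zeroʳ x ⟩
      0#         ∎
  ... | tri> _ _ x⁻¹<0 = ⊥-elim $ irrefl refl $ begin-strict
    0#         <⟨ 0<1 ⟩
    1#         ≈⟨ x*x⁻¹≈1 0<x ⟨
    x * x ⁻¹   ≈⟨ *-comm x (x ⁻¹) ⟩
    x ⁻¹ * x   <⟨ *-monoʳ-<-pos 0<x x⁻¹<0 ⟩
    0# * x     ≈⟨ zeroˡ x ⟩
    0#         ∎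

  x*z⁻¹≤1⇔x≤z : ∀ {x z} → 0# < z → x * z ⁻¹ ≤ 1# ⇔ x ≤ z
  x*z⁻¹≤1⇔x≤z {x} {z} 0<z = mk⇔
    (λ h → *-cancelʳ-≤-pos (⁻¹-pos 0<z) (≤-respʳ-≈ (sym (x*x⁻¹≈1 0<z)) h))
    (λ x≤z → ≤-respʳ-≈ (x*x⁻¹≈1 0<z) (*-monoʳ-≤-pos (⁻¹-pos 0<z) x≤z))

  x*z⁻¹≈1⇔x≈z : ∀ {x z} → 0# < z → x * z ⁻¹ ≈ 1# ⇔ x ≈ z
  x*z⁻¹≈1⇔x≈z {x} {z} 0<z = mk⇔
    (λ h → *-cancelʳ-≈-pos (⁻¹-pos 0<z) (trans h (sym (x*x⁻¹≈1 0<z))))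
    (λ x≈z → trans (*-congʳ x≈z) (x*x⁻¹≈1 0<z))

module FiniteSums {c ℓ₁ ℓ₂} (𝔽 : OrderedField c ℓ₁ ℓ₂) where
  open OrderedField 𝔽 hiding (zero)
  open OrderedFieldProperties 𝔽
  open Geometry 𝔽 using (sumF; Vect; _·_; e)
  open import Relation.Binary.Reasoning.StrictPartialOrder strictPartialOrder

  Σ² : ∀ {m n} → (Fin m → Fin n → Carrier) → Carrier
  Σ² f = sumF (λ i → sumF (f i))

  sumF-cong : ∀ {n} {f g : Fin n → Carrier} → (∀ k → f k ≈ g k) → sumF f ≈ sumF g
  sumF-cong {zero}  f≈g = refl
  sumF-cong {suc n} f≈g = +-cong (f≈g zero) (sumF-cong (f≈g ∘ suc))

  sumF-zero : ∀ {n} {f : Fin n → Carrier} → (∀ k → f k ≈ 0#) → sumF f ≈ 0#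
  sumF-zero {zero}  f≈0 = refl
  sumF-zero {suc n} f≈0 = trans (+-cong (f≈0 zero) (sumF-zero (f≈0 ∘ suc))) (+-identityʳ 0#)

  sumF-+ : ∀ {n} (f g : Fin n → Carrier) → sumF (λ k → f k + g k) ≈ sumF f + sumF g
  sumF-+ {zero}  f g = sym (+-identityʳ 0#)
  sumF-+ {suc n} f g =
    trans (+-congˡ (sumF-+ (f ∘ suc) (g ∘ suc))) (interchange +-commutativeSemigroup _ _ _ _)

  sumF-neg : ∀ {n} (f : Fin n → Carrier) → sumF (λ k → - f k) ≈ - sumF f
  sumF-neg {zero}  f = sym -0#≈0#
  sumF-neg {suc n} f = trans (+-congˡ (sumF-neg (f ∘ suc))) (⁻¹-∙-comm _ _)

  sumF-*ˡ : ∀ {n} x (f : Fin n → Carrier) → sumF (λ k → x * f k) ≈ x * sumF f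
  sumF-*ˡ {zero}  x f = sym (zeroʳ x)
  sumF-*ˡ {suc n} x f = trans (+-congˡ (sumF-*ˡ x (f ∘ suc))) (sym (distribˡ x _ _))

  sumF-*ʳ : ∀ {n} x (f : Fin n → Carrier) → sumF (λ k → f k * x) ≈ sumF f * x
  sumF-*ʳ {zero}  x f = sym (zeroˡ x)
  sumF-*ʳ {suc n} x f = trans (+-congˡ (sumF-*ʳ x (f ∘ suc))) (sym (distribʳ x _ _))

  Σ²-swap : ∀ {m n} (f : Fin m → Fin n → Carrier) → Σ² f ≈ Σ² (λ j i → f i j)
  Σ²-swap {zero} {n} f = sym (sumF-zero {n} (λ _ → refl))
  Σ²-swap {suc m} f =
    trans (+-congˡ (Σ²-swap (f ∘ suc))) (sym (sumF-+ (f zero) (λ j → sumF (λ i → f (suc i) j))))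

  sumF-mono : ∀ {n} {f g : Fin n → Carrier} → (∀ k → f k ≤ g k) → sumF f ≤ sumF g
  sumF-mono {zero}  f≤g = ≤-reflexive refl
  sumF-mono {suc n} f≤g = +-mono-≤ (f≤g zero) (sumF-mono (f≤g ∘ suc))

  sumF-≤-equality : ∀ {n} {f g : Fin n → Carrier} →
                    (∀ k → f k ≤ g k) → sumF f ≈ sumF g → ∀ k → f k ≈ g k
  sumF-≤-equality {suc n} f≤g Σf≈Σg zero    =
    proj₁ (+-≤-equality (f≤g zero) (sumF-mono (f≤g ∘ suc)) Σf≈Σg)
  sumF-≤-equality {suc n} f≤g Σf≈Σg (suc k) =
    sumF-≤-equality (f≤g ∘ suc) (proj₂ (+-≤-equality (f≤g zero) (sumF-mono (f≤g ∘ suc)) Σf≈Σg)) k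

  sumF-sift : ∀ {n} (i : Fin n) (f : Fin n → Carrier) → sumF (λ k → e i k * f k) ≈ f i
  sumF-sift {suc n} zero f = begin-equality
    1# * f zero + sumF (λ k → 0# * f (suc k))
      ≈⟨ +-cong (*-identityˡ _) (sumF-zero {n} (λ k → zeroˡ (f (suc k)))) ⟩
    f zero + 0#                                 ≈⟨ +-identityʳ _ ⟩
    f zero                                      ∎
  sumF-sift {suc n} (suc i) f = begin-equality
    0# * f zero + sumF (λ k → e i k * f (suc k))  ≈⟨ +-cong (zeroˡ _) (sumF-sift i (f ∘ suc)) ⟩
    0# + f (suc i)                                ≈⟨ +-identityˡ _ ⟩
    f (suc i)                                     ∎

  Σ²-cong : ∀ {m n} {f g : Fin m → Fin n → Carrier} → (∀ i j → f i j ≈ g i j) → Σ² f ≈ Σ² g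
  Σ²-cong f≈g = sumF-cong (λ i → sumF-cong (f≈g i))

  Σ²-mono : ∀ {m n} {f g : Fin m → Fin n → Carrier} → (∀ i j → f i j ≤ g i j) → Σ² f ≤ Σ² g
  Σ²-mono f≤g = sumF-mono (λ i → sumF-mono (f≤g i))

  Σ²-≤-equality : ∀ {m n} {f g : Fin m → Fin n → Carrier} →
                  (∀ i j → f i j ≤ g i j) → Σ² f ≈ Σ² g → ∀ i j → f i j ≈ g i j
  Σ²-≤-equality f≤g Σf≈Σg i =
    sumF-≤-equality (f≤g i) (sumF-≤-equality (λ i → sumF-mono (f≤g i)) Σf≈Σg i)

  Σ²-*ʳ : ∀ {m n} x (f : Fin m → Fin n → Carrier) → Σ² (λ i j → f i j * x) ≈ Σ² f * x
  Σ²-*ʳ x f = trans (sumF-cong (λ i → sumF-*ʳ x (f i))) (sumF-*ʳ x (λ i → sumF (f i)))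

  Σ²-sift : ∀ {n} (i j : Fin n) (f : Fin n → Fin n → Carrier) →
            Σ² (λ k l → (e i k * e j l) * f k l) ≈ f i j
  Σ²-sift i j f = begin-equality
    Σ² (λ k l → (e i k * e j l) * f k l)     ≈⟨ Σ²-cong (λ k l → *-assoc (e i k) (e j l) (f k l)) ⟩
    Σ² (λ k l → e i k * (e j l * f k l))     ≈⟨ sumF-cong (λ k → sumF-*ˡ (e i k) (λ l → e j l * f k l)) ⟩
    sumF (λ k → e i k * sumF (λ l → e j l * f k l))  ≈⟨ sumF-cong (λ k → *-congˡ (sumF-sift j (f k))) ⟩
    sumF (λ k → e i k * f k j)               ≈⟨ sumF-sift i (λ k → f k j) ⟩
    f i j                                    ∎

  ·-e-e : ∀ {n} (u : Vect n) i j → u · (λ k → e i k - e j k) ≈ u i - u j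
  ·-e-e u i j = begin-equality
    sumF (λ k → u k * (e i k - e j k))            ≈⟨ sumF-cong (λ k → x[y-z]≈xy-xz (u k) (e i k) (e j k)) ⟩
    sumF (λ k → u k * e i k - u k * e j k)        ≈⟨ sumF-+ (λ k → u k * e i k) (λ k → - (u k * e j k)) ⟩
    u · e i + sumF (λ k → - (u k * e j k))        ≈⟨ +-congˡ (sumF-neg (λ k → u k * e j k)) ⟩
    u · e i - u · e j                             ≈⟨ +-cong (·-e i) (-‿cong (·-e j)) ⟩
    u i - u j                                     ∎
    where
    ·-e : ∀ i → u · e i ≈ u i
    ·-e i = trans (sumF-cong (λ k → *-comm (u k) (e i k))) (sumF-sift i u)

  ·-*ʳ : ∀ {n} (u v : Vect n) x → u · (λ k → v k * x) ≈ (u · v) * x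
  ·-*ʳ u v x = trans (sumF-cong (λ k → sym (*-assoc (u k) (v k) x))) (sumF-*ʳ x (λ k → u k * v k))

  ·-*ˡ : ∀ {n} (u v : Vect n) x → u · (λ k → x * v k) ≈ x * (u · v)
  ·-*ˡ u v x = trans (sumF-cong (λ k → x∙yz≈y∙xz *-commutativeSemigroup (u k) x (v k)))
                     (sumF-*ˡ x (λ k → u k * v k))

  *ʳ-· : ∀ {n} (u v : Vect n) x → (λ k → u k * x) · v ≈ (u · v) * x
  *ʳ-· u v x = trans (sumF-cong (λ k → xy∙z≈xz∙y *-commutativeSemigroup (u k) x (v k)))
                     (sumF-*ʳ x (λ k → u k * v k))

  ·-sumF : ∀ {m n} (u x : Vect n) (P : Fin m → Vect n) →
           (∀ k → x k ≈ sumF (λ i → P i k)) → u · x ≈ sumF (λ i → u · P i)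
  ·-sumF u x P x≈ΣP = begin-equality
    sumF (λ k → u k * x k)                 ≈⟨ sumF-cong (λ k → *-congˡ (x≈ΣP k)) ⟩
    sumF (λ k → u k * sumF (λ i → P i k))  ≈⟨ sumF-cong (λ k → sumF-*ˡ (u k) (λ i → P i k)) ⟨
    Σ² (λ k i → u k * P i k)               ≈⟨ Σ²-swap (λ k i → u k * P i k) ⟩
    sumF (λ i → u · P i)                   ∎

module Faces {c ℓ₁ ℓ₂} (𝔽 : OrderedField c ℓ₁ ℓ₂) {n : ℕ}
             (ρ : Fin n → Fin n → OrderedField.Carrier 𝔽)
             (ρ-pos : ∀ {i j} → i ≢ j → OrderedField._<_ 𝔽 (OrderedField.0# 𝔽) (ρ i j)) where
  open OrderedField 𝔽 hiding (zero)
  open OrderedFieldProperties 𝔽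
  open FiniteSums 𝔽
  open Geometry 𝔽
  open import Relation.Binary.Reasoning.StrictPartialOrder strictPartialOrder

  ·p≈ : ∀ (w : Vect n) i j → w · p ρ i j ≈ (w i - w j) * ρ i j ⁻¹
  ·p≈ w i j = trans (·-*ʳ w _ (ρ i j ⁻¹)) (*-congʳ (·-e-e w i j))

  ·p-diag : ∀ (w : Vect n) i → w · p ρ i i ≈ 0#
  ·p-diag w i = trans (·p≈ w i i) (trans (*-congʳ (-‿inverseʳ (w i))) (zeroˡ _))

  ·p≤0⇔ : ∀ (w : Vect n) {i j} → i ≢ j → w · p ρ i j ≤ 0# ⇔ w i ≤ w j
  ·p≤0⇔ w {i} {j} i≢j = x-y≤0⇔x≤y ⇔-∘ (x*z≤0⇔x≤0 (⁻¹-pos (ρ-pos i≢j)) ⇔-∘ ≤-congˡ-⇔ (·p≈ w i j))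

  vertex∈KRW : ∀ {i j} → i ≢ j → InKRW ρ (p ρ i j)
  vertex∈KRW {i} {j} i≢j = (λ k l → e i k * e j l) , weight≥0 , weightᵢᵢ≈0 , Σweight≈1 ,
                            λ m → sym (Σ²-sift i j (λ k l → p ρ k l m))
    where
    e≥0 : ∀ k l → 0# ≤ e k l
    e≥0 k l with does (k ≟ l)
    ... | true  = inj₁ 0<1
    ... | false = inj₂ refl
    weight≥0 : ∀ k l → 0# ≤ e i k * e j l
    weight≥0 k l = ≤-respˡ-≈ (zeroʳ (e i k)) (*-monoˡ-≤-nonNeg (e≥0 i k) (e≥0 j l))
    weightᵢᵢ≈0 : ∀ k → e i k * e j k ≈ 0#
    weightᵢᵢ≈0 k with i ≟ k | j ≟ k
    ... | yes ≡.refl | yes ≡.refl = ⊥-elim (i≢j ≡.refl)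
    ... | yes _      | no _       = zeroʳ 1#
    ... | no _       | _          = zeroˡ _
    Σweight≈1 : Σ² (λ k l → e i k * e j l) ≈ 1#
    Σweight≈1 = trans (Σ²-cong (λ k l → sym (*-identityʳ (e i k * e j l))))
                      (Σ²-sift i j (λ _ _ → 1#))

  weight : ∀ {x} → InKRW ρ x → Fin n → Fin n → Carrier
  weight = proj₁

  weight-offDiag : ∀ {x} (x∈ : InKRW ρ x) i j → weight x∈ i j ≈ 0# ⊎ i ≢ j
  weight-offDiag (_ , _ , tᵢᵢ≈0 , _) i j with i ≟ j
  ... | yes ≡.refl = inj₁ (tᵢᵢ≈0 i)
  ... | no i≢j     = inj₂ i≢j

  ·-KRW : ∀ (w : Vect n) {x} (x∈ : InKRW ρ x) → w · x ≈ Σ² (λ i j → weight x∈ i j * (w · p ρ i j))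
  ·-KRW w {x} (t , _ , _ , _ , x≈Σtp) = begin-equality
    w · x
      ≈⟨ ·-sumF w x (λ i k → sumF (λ j → t i j * p ρ i j k)) x≈Σtp ⟩
    sumF (λ i → w · (λ k → sumF (λ j → t i j * p ρ i j k)))
      ≈⟨ sumF-cong (λ i → ·-sumF w _ (λ j k → t i j * p ρ i j k) (λ _ → refl)) ⟩
    Σ² (λ i j → w · (λ k → t i j * p ρ i j k))
      ≈⟨ Σ²-cong (λ i j → ·-*ˡ w (p ρ i j) (t i j)) ⟩
    Σ² (λ i j → t i j * (w · p ρ i j))
      ∎

  Σ²-weight* : ∀ {x} (x∈ : InKRW ρ x) M → Σ² (λ i j → weight x∈ i j * M) ≈ M
  Σ²-weight* (t , _ , _ , Σt≈1 , _) M = trans (Σ²-*ʳ M t) (trans (*-congʳ Σt≈1) (*-identityˡ M))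

  Bounded : Vect n → Carrier → Set (ℓ₁ ⊔ ℓ₂)
  Bounded w M = ∀ {i j} → i ≢ j → w · p ρ i j ≤ M

  weighted-≤ : ∀ {w M x} → Bounded w M → (x∈ : InKRW ρ x) →
               ∀ i j → weight x∈ i j * (w · p ρ i j) ≤ weight x∈ i j * M
  weighted-≤ w≤M x∈ i j with weight-offDiag x∈ i j
  ... | inj₁ tᵢⱼ≈0 = ≤-reflexive (x≈0⇒x*y≈x*z tᵢⱼ≈0)
  ... | inj₂ i≢j   = *-monoˡ-≤-nonNeg (proj₁ (proj₂ x∈) i j) (w≤M i≢j)

  ·-≤-bound : ∀ {w M x} → Bounded w M → InKRW ρ x → w · x ≤ M
  ·-≤-bound {w} {M} {x} w≤M x∈ = begin
    w · x                                        ≈⟨ ·-KRW w x∈ ⟩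
    Σ² (λ i j → weight x∈ i j * (w · p ρ i j))  ≤⟨ Σ²-mono (weighted-≤ w≤M x∈) ⟩
    Σ² (λ i j → weight x∈ i j * M)              ≈⟨ Σ²-weight* x∈ M ⟩
    M                                            ∎

  ·-≈-bound⇒support-tight : ∀ {w M x} → Bounded w M → (x∈ : InKRW ρ x) → w · x ≈ M →
                            ∀ i j → weight x∈ i j ≈ 0# ⊎ (i ≢ j × w · p ρ i j ≈ M)
  ·-≈-bound⇒support-tight {w} {M} w≤M x∈ w·x≈M i j
    with weight-offDiag x∈ i j | proj₁ (proj₂ x∈) i j
  ... | inj₁ tᵢⱼ≈0 | _          = inj₁ tᵢⱼ≈0
  ... | inj₂ _     | inj₂ 0≈tᵢⱼ = inj₁ (sym 0≈tᵢⱼ)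
  ... | inj₂ i≢j   | inj₁ 0<tᵢⱼ = inj₂ (i≢j , *-cancelˡ-≈-pos 0<tᵢⱼ termᵢⱼ≈)
    where
    termᵢⱼ≈ : weight x∈ i j * (w · p ρ i j) ≈ weight x∈ i j * M
    termᵢⱼ≈ = Σ²-≤-equality (weighted-≤ w≤M x∈)
                (trans (sym (·-KRW w x∈)) (trans w·x≈M (sym (Σ²-weight* x∈ M)))) i j

  ·-≈-on-support : ∀ {u N x} (x∈ : InKRW ρ x) →
                   (∀ i j → weight x∈ i j ≈ 0# ⊎ u · p ρ i j ≈ N) → u · x ≈ N
  ·-≈-on-support {u} {N} {x} x∈ support = begin-equality
    u · x                                        ≈⟨ ·-KRW u x∈ ⟩
    Σ² (λ i j → weight x∈ i j * (u · p ρ i j))  ≈⟨ Σ²-cong term ⟩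
    Σ² (λ i j → weight x∈ i j * N)              ≈⟨ Σ²-weight* x∈ N ⟩
    N                                            ∎
    where
    term : ∀ i j → weight x∈ i j * (u · p ρ i j) ≈ weight x∈ i j * N
    term i j with support i j
    ... | inj₁ tᵢⱼ≈0 = x≈0⇒x*y≈x*z tᵢⱼ≈0
    ... | inj₂ uᵢⱼ≈N = *-congˡ uᵢⱼ≈N

  record IsMaximum (w : Vect n) (M : Carrier) : Set (ℓ₁ ⊔ ℓ₂) where
    field
      bounded  : Bounded w M
      i₀ j₀    : Fin n
      i₀≢j₀    : i₀ ≢ j₀
      attained : w · p ρ i₀ j₀ ≈ M

  face-intro : ∀ {w M x} → Bounded w M → InKRW ρ x → w · x ≈ M → Face ρ w x
  face-intro w≤M x∈ w·x≈M = x∈ , λ y y∈ → ≤-respʳ-≈ (sym w·x≈M) (·-≤-bound w≤M y∈)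

  face-value : ∀ {w M x} → IsMaximum w M → Face ρ w x → w · x ≈ M
  face-value max (x∈ , x-max) =
    ≤-antisym (·-≤-bound bounded x∈) (≤-respˡ-≈ attained (x-max (p ρ i₀ j₀) (vertex∈KRW i₀≢j₀)))
    where open IsMaximum max

  vertex∈face⇔ : ∀ {w M i j} → IsMaximum w M → i ≢ j → Face ρ w (p ρ i j) ⇔ w · p ρ i j ≈ M
  vertex∈face⇔ max i≢j = mk⇔ (face-value max) (face-intro (IsMaximum.bounded max) (vertex∈KRW i≢j))

  face-mono : ∀ {w M u N x} → IsMaximum w M → Bounded u N →
              (∀ {i j} → i ≢ j → w · p ρ i j ≈ M → u · p ρ i j ≈ N) → Face ρ w x → Face ρ u x
  face-mono {u = u} {N} max u≤N tight⊆tight (x∈ , x-max) = face-intro u≤N x∈ (·-≈-on-support x∈ support)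
    where
    support : ∀ i j → weight x∈ i j ≈ 0# ⊎ u · p ρ i j ≈ N
    support i j = Sum.map₂ (λ (i≢j , wᵢⱼ≈M) → tight⊆tight i≢j wᵢⱼ≈M)
                (·-≈-bound⇒support-tight (IsMaximum.bounded max) x∈ (face-value max (x∈ , x-max)) i j)

  nonpositive-bound⇒face : ∀ {w M x} → Bounded w M → M ≤ 0# → InKRW ρ x → Face ρ w x
  nonpositive-bound⇒face {w} w≤M M≤0 x∈ =
    face-intro w≤0 x∈ (·-≈-on-support x∈ (λ i j → Sum.map₂ slope≈0 (weight-offDiag x∈ i j)))
    where
    w≤0 : Bounded w 0#
    w≤0 i≢j = ≤-trans (w≤M i≢j) M≤0
    slope≈0 : ∀ {i j} → i ≢ j → w · p ρ i j ≈ 0#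
    slope≈0 {i} {j} i≢j = begin-equality
      w · p ρ i j               ≈⟨ ·p≈ w i j ⟩
      (w i - w j) * ρ i j ⁻¹   ≈⟨ *-congʳ (+-congˡ (-‿cong wᵢ≈wⱼ)) ⟨
      (w i - w i) * ρ i j ⁻¹   ≈⟨ *-congʳ (-‿inverseʳ (w i)) ⟩
      0# * ρ i j ⁻¹            ≈⟨ zeroˡ _ ⟩
      0#                        ∎
      where
      wᵢ≈wⱼ : w i ≈ w j
      wᵢ≈wⱼ = ≤-antisym (to (·p≤0⇔ w i≢j) (w≤0 i≢j))
                        (to (·p≤0⇔ w (≢-sym i≢j)) (w≤0 (≢-sym i≢j)))

  proper⇒0<bound : ∀ {w M} → ProperFace ρ w → Bounded w M → 0# < M
  proper⇒0<bound {w} {M} (x , x∈ , x∉face) w≤M with compare 0# M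
  ... | tri< 0<M _ _ = 0<M
  ... | tri≈ _ 0≈M _ = ⊥-elim (x∉face (nonpositive-bound⇒face w≤M (inj₂ (sym 0≈M)) x∈))
  ... | tri> _ _ M<0 = ⊥-elim (x∉face (nonpositive-bound⇒face w≤M (inj₁ M<0) x∈))

  nonpositive-slope : ∀ (w : Vect n) {o o'} → o ≢ o' → ∃₂ λ k l → k ≢ l × w · p ρ k l ≤ 0#
  nonpositive-slope w {o} {o'} o≢o' with ≤-total (w o) (w o')
  ... | inj₁ wₒ≤wₒ' = o , o' , o≢o' , from (·p≤0⇔ w o≢o') wₒ≤wₒ'
  ... | inj₂ wₒ'≤wₒ = o' , o , ≢-sym o≢o' , from (·p≤0⇔ w (≢-sym o≢o')) wₒ'≤wₒ

  0<max⇒proper : ∀ {w M o o'} → o ≢ o' → IsMaximum w M → 0# < M → ProperFace ρ w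
  0<max⇒proper {w} {M} o≢o' max 0<M with nonpositive-slope w o≢o'
  ... | k , l , k≢l , wₖₗ≤0 = p ρ k l , vertex∈KRW k≢l , λ face → irrefl refl $ begin-strict
    M            ≈⟨ face-value max face ⟨
    w · p ρ k l  ≤⟨ wₖₗ≤0 ⟩
    0#           <⟨ 0<M ⟩
    M            ∎

  maximum-of-proper : ∀ {w} → Fin n → ProperFace ρ w → Σ Carrier (IsMaximum w)
  maximum-of-proper {w} o proper = w · p ρ a b , record
    { bounded = λ {i} {j} _ → below-max i j ; i₀ = a ; j₀ = b ; i₀≢j₀ = a≢b ; attained = refl }
    where
    open Extrema (StrictTotalOrderProperties.totalOrder strictTotalOrder)
    slope : Fin n × Fin n → Carrier
    slope (i , j) = w · p ρ i j
    pairs : List (Fin n × Fin n)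
    pairs = cartesianProduct (allFin n) (allFin n)
    a b : Fin n
    a = proj₁ (argmax slope (o , o) pairs)
    b = proj₂ (argmax slope (o , o) pairs)
    below-max : ∀ i j → w · p ρ i j ≤ w · p ρ a b
    below-max i j =
      All.lookup (f[xs]≤f[argmax] (o , o) pairs) (∈-cartesianProduct⁺ (∈-allFin i) (∈-allFin j))
    a≢b : a ≢ b
    a≢b a≡b = irrefl (sym (·p-diag w b)) (≡.subst (λ i → 0# < w · p ρ i b) a≡b 0<max)
      where
      0<max : 0# < w · p ρ a b
      0<max = proper⇒0<bound proper (λ {i} {j} _ → below-max i j)

  _÷_ : Vect n → Carrier → Vect n
  (w ÷ M) k = w k * M ⁻¹

  ÷-tight : ∀ {w M i j} → 0# < M → (w ÷ M) · p ρ i j ≈ 1# ⇔ w · p ρ i j ≈ M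
  ÷-tight {w} {M} {i} {j} 0<M = x*z⁻¹≈1⇔x≈z 0<M ⇔-∘ ≈-congˡ-⇔ (*ʳ-· w (p ρ i j) (M ⁻¹))

  ÷-bounded : ∀ {w M} → 0# < M → Bounded w M → Bounded (w ÷ M) 1#
  ÷-bounded {w} {M} 0<M w≤M {i} {j} i≢j =
    from (x*z⁻¹≤1⇔x≤z 0<M ⇔-∘ ≤-congˡ-⇔ (*ʳ-· w (p ρ i j) (M ⁻¹))) (w≤M i≢j)

module Cells {c ℓ₁ ℓ₂} (𝔽 : OrderedField c ℓ₁ ℓ₂) {n : ℕ}
             (ρ : Fin n → Fin n → OrderedField.Carrier 𝔽)
             (ρ-pos : ∀ {i j} → i ≢ j → OrderedField._<_ 𝔽 (OrderedField.0# 𝔽) (ρ i j)) where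
  open OrderedField 𝔽 hiding (zero)
  open OrderedFieldProperties 𝔽
  open FiniteSums 𝔽
  open Geometry 𝔽
  open Faces 𝔽 ρ ρ-pos using (Bounded; IsMaximum; face-mono)

  ·pt-origin : ∀ (u : Vect n) → u · pt ρ nothing ≈ 0#
  ·pt-origin u = sumF-zero (λ k → zeroʳ (u k))

  ·p≤1⇔·pt≤ρ : ∀ (u : Vect n) {i j} (i≢j : i ≢ j) →
               u · p ρ i j ≤ 1# ⇔ u · pt ρ (just ((i , j) , i≢j)) ≤ ρ i j
  ·p≤1⇔·pt≤ρ u {i} {j} i≢j = x*z⁻¹≤1⇔x≤z (ρ-pos i≢j) ⇔-∘ ≤-congˡ-⇔ (·-*ʳ u _ (ρ i j ⁻¹))

  ·p≈1⇔·pt≈ρ : ∀ (u : Vect n) {i j} (i≢j : i ≢ j) →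
               u · p ρ i j ≈ 1# ⇔ u · pt ρ (just ((i , j) , i≢j)) ≈ ρ i j
  ·p≈1⇔·pt≈ρ u {i} {j} i≢j = x*z⁻¹≈1⇔x≈z (ρ-pos i≢j) ⇔-∘ ≈-congˡ-⇔ (·-*ʳ u _ (ρ i j ⁻¹))

  cell⇔ : ∀ {S} (cS : IsCell ρ S) a → S a ≡ true ⇔ proj₁ cS · pt ρ a ≈ ht ρ a
  cell⇔ {S} (u , u-cell) a = mk⇔ (proj₁ (u-cell a)) tight⇒S
    where
    tight⇒S : u · pt ρ a ≈ ht ρ a → S a ≡ true
    tight⇒S tight with S a in Sa≡
    ... | true  = ≡.refl
    ... | false = ⊥-elim (irrefl tight (proj₂ (u-cell a) Sa≡))

  cell-below : ∀ {S} (cS : IsCell ρ S) a → proj₁ cS · pt ρ a ≤ ht ρ a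
  cell-below {S} (u , u-cell) a with S a in Sa≡
  ... | true  = inj₂ (proj₁ (u-cell a) Sa≡)
  ... | false = inj₁ (proj₂ (u-cell a) Sa≡)

  cell-origin : ∀ {S} → IsCell ρ S → S nothing ≡ true
  cell-origin cS = from (cell⇔ cS nothing) (·pt-origin (proj₁ cS))

  cell-bounded : ∀ {S} (cS : IsCell ρ S) → Bounded (proj₁ cS) 1#
  cell-bounded cS i≢j = from (·p≤1⇔·pt≤ρ (proj₁ cS) i≢j) (cell-below cS (just (_ , i≢j)))

  cell-tight : ∀ {S} (cS : IsCell ρ S) {i j} (i≢j : i ≢ j) →
               S (just ((i , j) , i≢j)) ≡ true ⇔ proj₁ cS · p ρ i j ≈ 1#
  cell-tight cS i≢j = ⇔-sym (·p≈1⇔·pt≈ρ (proj₁ cS) i≢j) ⇔-∘ cell⇔ cS (just (_ , i≢j))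

  cell-intro : ∀ {u S} → Bounded u 1# → S nothing ≡ true →
               (∀ {i j} (i≢j : i ≢ j) → S (just ((i , j) , i≢j)) ≡ true ⇔ u · p ρ i j ≈ 1#) → IsCell ρ S
  cell-intro {u} {S} u≤1 S₀ S⇔tight = u , λ where
    nothing → (λ _ → ·pt-origin u) , ⊥-elim ∘ not-¬ S₀
    (just ((i , j) , i≢j)) →
        to (·p≈1⇔·pt≈ρ u i≢j) ∘ to (S⇔tight i≢j)
      , λ Sᵢⱼ≡false → ≤∧≉⇒< (to (·p≤1⇔·pt≤ρ u i≢j) (u≤1 i≢j))
          (λ tight → not-¬ (from (S⇔tight i≢j) (from (·p≈1⇔·pt≈ρ u i≢j) tight)) Sᵢⱼ≡false)

  cell-maximum : ∀ {S} (cS : IsCell ρ S) {i j} (i≢j : i ≢ j) → S (just ((i , j) , i≢j)) ≡ true →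
                 IsMaximum (proj₁ cS) 1#
  cell-maximum cS i≢j Sᵢⱼ = record
    { bounded = cell-bounded cS ; i₀ = _ ; j₀ = _ ; i₀≢j₀ = i≢j ; attained = to (cell-tight cS i≢j) Sᵢⱼ }

  face-mono-cell : ∀ {w M S x} → IsMaximum w M → (cS : IsCell ρ S) →
                   (∀ {i j} (i≢j : i ≢ j) → w · p ρ i j ≈ M → S (just ((i , j) , i≢j)) ≡ true) →
                   Face ρ w x → Face ρ (proj₁ cS) x
  face-mono-cell w-max cS tight⊆S =
    face-mono w-max (cell-bounded cS) (λ i≢j → to (cell-tight cS i≢j) ∘ tight⊆S i≢j)

  cell-irrelevant : ∀ {S} → IsCell ρ S → ∀ {i j} (q q' : i ≢ j) →
                    S (just ((i , j) , q)) ≡ true → S (just ((i , j) , q')) ≡ true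
  cell-irrelevant cS q q' = from (cell⇔ cS (just (_ , q'))) ∘ to (cell⇔ cS (just (_ , q)))

  tightCell : Vect n → Pt n → Bool
  tightCell u nothing                = true
  tightCell u (just ((i , j) , _)) = does (u · p ρ i j ≈? 1#)

  tightCell⇔ : ∀ (u : Vect n) {i j} (i≢j : i ≢ j) →
               tightCell u (just ((i , j) , i≢j)) ≡ true ⇔ u · p ρ i j ≈ 1#
  tightCell⇔ u {i} {j} _ with u · p ρ i j ≈? 1#
  ... | yes tight = mk⇔ (λ _ → tight) (λ _ → ≡.refl)
  ... | no ¬tight = mk⇔ (λ ()) (⊥-elim ∘ ¬tight)

  tightCell-isCell : ∀ {u} → Bounded u 1# → IsCell ρ (tightCell u)
  tightCell-isCell {u} u≤1 = cell-intro u≤1 ≡.refl (tightCell⇔ u)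

module Correspondence {c ℓ₁ ℓ₂} (𝔽 : OrderedField c ℓ₁ ℓ₂) {n : ℕ}
                      (ρ : Fin n → Fin n → OrderedField.Carrier 𝔽) (metric : Geometry.IsMetric 𝔽 n ρ)
                      {o o' : Fin n} (o≢o' : o ≢ o') where
  open OrderedField 𝔽 hiding (zero)
  open OrderedFieldProperties 𝔽
  open FiniteSums 𝔽
  open Geometry 𝔽
  open IsMetric metric
  open Faces 𝔽 ρ (pos _ _)
  open Cells 𝔽 ρ (pos _ _)
  open import Relation.Binary.Reasoning.StrictPartialOrder strictPartialOrder

  cell-neg : ∀ {S} → IsCell ρ S → IsCell ρ (S ∘ negPt)
  cell-neg {S} (u , u-cell) = -u , λ a →
      (λ S-a → begin-equality
        -u · pt ρ a              ≈⟨ ·pt-neg a ⟩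
        u · pt ρ (negPt a)       ≈⟨ proj₁ (u-cell (negPt a)) S-a ⟩
        ht ρ (negPt a)           ≈⟨ ht-neg a ⟨
        ht ρ a                   ∎)
    , (λ S-a≡false → begin-strict
        -u · pt ρ a              ≈⟨ ·pt-neg a ⟩
        u · pt ρ (negPt a)       <⟨ proj₂ (u-cell (negPt a)) S-a≡false ⟩
        ht ρ (negPt a)           ≈⟨ ht-neg a ⟨
        ht ρ a                   ∎)
    where
    -u : Vect n
    -u k = - u k
    ·pt-neg : ∀ a → -u · pt ρ a ≈ u · pt ρ (negPt a)
    ·pt-neg nothing                = trans (·pt-origin -u) (sym (·pt-origin u))
    ·pt-neg (just ((i , j) , _)) = begin-equality
      -u · (λ k → e i k - e j k)  ≈⟨ ·-e-e -u i j ⟩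
      - u i - - u j               ≈⟨ -x--y≈y-x (u i) (u j) ⟩
      u j - u i                   ≈⟨ ·-e-e u j i ⟨
      u · (λ k → e j k - e i k)   ∎
    ht-neg : ∀ a → ht ρ a ≈ ht ρ (negPt a)
    ht-neg nothing                = refl
    ht-neg (just ((i , j) , _)) = symm i j

  -- negPt (negPt a) is a only up to the proof of i ≢ j, which a cell cannot observe.
  cell-negPt-negPt : ∀ {S} → IsCell ρ S → ∀ a → S a ≡ true → S (negPt (negPt a)) ≡ true
  cell-negPt-negPt cS nothing              = id
  cell-negPt-negPt cS (just ((i , j) , q)) = cell-irrelevant cS q (≢-sym (≢-sym q))

  maximalCell-neg : ∀ S → IsMaximalCell ρ S → IsMaximalCell ρ (S ∘ negPt)
  maximalCell-neg S (cS , S-max) = cell-neg cS , λ S' cS' S∘negPt⊆S' a S'a →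
    S-max (S' ∘ negPt) (cell-neg cS') (λ b Sb → S∘negPt⊆S' (negPt b) (cell-negPt-negPt cS b Sb))
          (negPt a) (cell-negPt-negPt cS' a S'a)

  maximalCell-origin : ∀ S → IsMaximalCell ρ S → S nothing ≡ true
  maximalCell-origin S (cS , _) = cell-origin cS

  maximalCell-nonempty : ∀ {I} → IsMaximalCell ρ (cellOf ρ I) → ∃₂ λ a b → I a b ≡ true
  maximalCell-nonempty {I} (_ , I-max) with any? (λ a → any? (λ b → I a b ≟ᵇ true))
  ... | yes (a , b , Iab) = a , b , Iab
  -- Otherwise cellOf I = {0} lies in the cell of ρ(·, o), which also contains e_o' − e_o.
  ... | no ∄Iab = o' , o , I-max (tightCell dist-o) (tightCell-isCell dist-o≤1) I⊆tight (just (_ , o'≢o))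
                              (from (tightCell⇔ dist-o o'≢o) dist-o-tight)
    where
    o'≢o : o' ≢ o
    o'≢o = ≢-sym o≢o'
    dist-o : Vect n
    dist-o k = ρ k o
    dist-o≤1 : Bounded dist-o 1#
    dist-o≤1 {i} {j} i≢j = from (·p≤1⇔·pt≤ρ dist-o i≢j) $ begin
      dist-o · pt ρ (just (_ , i≢j))  ≈⟨ ·-e-e dist-o i j ⟩
      ρ i o - ρ j o                   ≤⟨ x≤y+z⇒x-z≤y (triangle i j o) ⟩
      ρ i j                           ∎
    dist-o-tight : dist-o · p ρ o' o ≈ 1#
    dist-o-tight = from (·p≈1⇔·pt≈ρ dist-o o'≢o) $ begin-equality
      dist-o · pt ρ (just (_ , o'≢o))  ≈⟨ ·-e-e dist-o o' o ⟩
      ρ o' o - ρ o o                   ≈⟨ +-congˡ (trans (-‿cong (diag o)) -0#≈0#) ⟩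
      ρ o' o + 0#                      ≈⟨ +-identityʳ (ρ o' o) ⟩
      ρ o' o                           ∎
    I⊆tight : ∀ a → cellOf ρ I a ≡ true → tightCell dist-o a ≡ true
    I⊆tight nothing              _   = ≡.refl
    I⊆tight (just ((i , j) , _)) Iᵢⱼ = ⊥-elim (∄Iab (i , j , Iᵢⱼ))

  facet⇒maximalCell : ∀ I → FacetPointSet ρ I → IsMaximalCell ρ (cellOf ρ I)
  facet⇒maximalCell I (w , (w-proper , w-facet) , I⇔face) = I-cell , I-max
    where
    M : Carrier
    M = proj₁ (maximum-of-proper o w-proper)
    w-max : IsMaximum w M
    w-max = proj₂ (maximum-of-proper o w-proper)
    open IsMaximum w-max
    0<M : 0# < M
    0<M = proper⇒0<bound w-proper bounded
    I⇔tight : ∀ {i j} (i≢j : i ≢ j) → I i j ≡ true ⇔ w · p ρ i j ≈ M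
    I⇔tight i≢j = vertex∈face⇔ w-max i≢j ⇔-∘ I⇔face _ _ i≢j
    I-cell : IsCell ρ (cellOf ρ I)
    I-cell = cell-intro (÷-bounded 0<M bounded) ≡.refl
                        (λ i≢j → ⇔-sym (÷-tight 0<M) ⇔-∘ I⇔tight i≢j)
    I-max : ∀ S → IsCell ρ S → (∀ a → cellOf ρ I a ≡ true → S a ≡ true) →
            ∀ a → S a ≡ true → cellOf ρ I a ≡ true
    I-max S cS I⊆S nothing              _   = ≡.refl
    I-max S cS I⊆S (just ((i , j) , i≢j)) Sᵢⱼ =
      from (I⇔face i j i≢j) (w-facet u (λ _ → face-mono-cell w-max cS tight⊆S) u-proper
                                     (p ρ i j) (from (vertex∈face⇔ u-max i≢j) (to (cell-tight cS i≢j) Sᵢⱼ)))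
      where
      u : Vect n
      u = proj₁ cS
      tight⊆S : ∀ {k l} (k≢l : k ≢ l) → w · p ρ k l ≈ M → S (just ((k , l) , k≢l)) ≡ true
      tight⊆S k≢l = I⊆S (just (_ , k≢l)) ∘ from (I⇔tight k≢l)
      u-max : IsMaximum u 1#
      u-max = cell-maximum cS i₀≢j₀ (tight⊆S i₀≢j₀ attained)
      u-proper : ProperFace ρ u
      u-proper = 0<max⇒proper o≢o' u-max 0<1

  maximalCell⇒facet : ∀ I → (∀ i → I i i ≡ false) → IsMaximalCell ρ (cellOf ρ I) → FacetPointSet ρ I
  maximalCell⇒facet I I-irrefl (I-cell , I-max) = v , (v-proper , v-facet) , I⇔face
    where
    v : Vect n
    v = proj₁ I-cell
    v-max : IsMaximum v 1#
    v-max with maximalCell-nonempty (I-cell , I-max)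
    ... | a , b , Iab = cell-maximum I-cell (λ { ≡.refl → not-¬ Iab (I-irrefl a) }) Iab
    open IsMaximum v-max using (i₀; j₀; i₀≢j₀; attained)
    I⇔face : ∀ i j → i ≢ j → I i j ≡ true ⇔ Face ρ v (p ρ i j)
    I⇔face i j i≢j = ⇔-sym (vertex∈face⇔ v-max i≢j) ⇔-∘ cell-tight I-cell i≢j
    v-proper : ProperFace ρ v
    v-proper = 0<max⇒proper o≢o' v-max 0<1
    v-facet : ∀ w → (∀ x → Face ρ v x → Face ρ w x) → ProperFace ρ w → ∀ x → Face ρ w x → Face ρ v x
    v-facet w v⊆w w-proper _ = face-mono-cell w-max I-cell tight⊆I
      where
      M : Carrier
      M = w · p ρ i₀ j₀
      w≤M : Bounded w M
      w≤M i≢j = proj₂ (v⊆w _ (from (vertex∈face⇔ v-max i₀≢j₀) attained)) _ (vertex∈KRW i≢j)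
      w-max : IsMaximum w M
      w-max = record { bounded = w≤M ; i₀ = i₀ ; j₀ = j₀ ; i₀≢j₀ = i₀≢j₀ ; attained = refl }
      0<M : 0# < M
      0<M = proper⇒0<bound w-proper w≤M
      T⇔tight : ∀ {i j} (i≢j : i ≢ j) → tightCell (w ÷ M) (just (_ , i≢j)) ≡ true ⇔ w · p ρ i j ≈ M
      T⇔tight i≢j = ÷-tight 0<M ⇔-∘ tightCell⇔ (w ÷ M) i≢j
      I⊆T : ∀ a → cellOf ρ I a ≡ true → tightCell (w ÷ M) a ≡ true
      I⊆T nothing                _   = ≡.refl
      I⊆T (just ((i , j) , i≢j)) Iᵢⱼ =
        from (T⇔tight i≢j) (to (vertex∈face⇔ w-max i≢j) (v⊆w _ (to (I⇔face i j i≢j) Iᵢⱼ)))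
      tight⊆I : ∀ {i j} (i≢j : i ≢ j) → w · p ρ i j ≈ M → I i j ≡ true
      tight⊆I i≢j = I-max (tightCell (w ÷ M)) (tightCell-isCell (÷-bounded 0<M w≤M)) I⊆T (just (_ , i≢j))
                    ∘ from (T⇔tight i≢j)

open import Data.Nat using (_≤_; s≤s; z≤n)

proposition4p3 : ∀ {c ℓ₁ ℓ₂} (𝔽 : OrderedField c ℓ₁ ℓ₂) (n : ℕ) → 2 ≤ n →
    (ρ : Fin n → Fin n → OrderedField.Carrier 𝔽) → Geometry.IsMetric 𝔽 n ρ →
    ((∀ S → Geometry.IsMaximalCell 𝔽 ρ S → Geometry.IsMaximalCell 𝔽 ρ (S ∘ negPt))
      × (∀ S → Geometry.IsMaximalCell 𝔽 ρ S → S nothing ≡ true))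
    × (∀ (I : Fin n → Fin n → Bool) → (∀ i → I i i ≡ false) →
        (Geometry.FacetPointSet 𝔽 ρ I ⇔ Geometry.IsMaximalCell 𝔽 ρ (Geometry.cellOf 𝔽 ρ I)))
proposition4p3 𝔽 (suc (suc _)) (s≤s (s≤s z≤n)) ρ metric =
  (maximalCell-neg , maximalCell-origin) ,
  λ I I-irrefl → mk⇔ (facet⇒maximalCell I) (maximalCell⇒facet I I-irrefl)
  where open Correspondence 𝔽 ρ metric {zero} {suc zero} (λ ())
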